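{- Let $G$ be a simple graph on $n$ vertices. If $\alpha,\alpha''$ are acyclic orientations of $G$ that are double-flip equivalent, then $\alpha''$ can be reached from $\alpha$ by at most $4n^4(1+o(1))$ double-flips, where the $o(1)$ term depends only on $n$ and tends to $0$ as $n\to\infty$.
   Context: An acyclic orientation of $G$ is an orientation of all edges with no directed cycle. A double-flip takes an acyclic orientation with a source $v$ and a sink $w$ that are nonadjacent in $G$, and reverses all edges incident to $v$ and all edges incident to $w$, so that $v$ becomes a sink and $w$ a source. Two acyclic orientations are double-flip equivalent if one can be reached from the other by a sequence of double-flips. -}

module Defs where

open import Data.Nat using (ℕ; zero; suc)
open import Data.Fin using (Fin)
open import Data.Bool using (Bool; true; false; _∨_; if_then_else_)
open import Data.Product using (Σ; _×_; ∃; ∃-syntax)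
open import Relation.Binary.PropositionalEquality using (_≡_; _≢_)
open import Relation.Binary.Construct.Closure.Transitive using (TransClosure)
open import Relation.Nullary using (¬_)
open import Relation.Nullary.Decidable using (⌊_⌋)
open import Data.Fin using (_≟_)
open import Data.Sum using (_⊎_)
import Data.Nat as ℕ
import Data.Integer as ℤ
open import Data.Rational using (ℚ; _/_; _<_; _≤_; _+_; _*_; ∣_∣; 0ℚ; 1ℚ)

record SimpleGraph (n : ℕ) : Set where
  field
    adj   : Fin n → Fin n → Bool
    sym   : ∀ u v → adj u v ≡ adj v u
    irrfl : ∀ v → adj v v ≡ false
open SimpleGraph public

-- A (candidate) orientation: o u v ≡ true means the arc u → v is present.
Orient : ℕ → Set
Orient n = Fin n → Fin n → Bool

record IsOrientation {n : ℕ} (G : SimpleGraph n) (o : Orient n) : Set where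
  field
    arc⇒adj : ∀ u v → o u v ≡ true → adj G u v ≡ true
    adj⇒arc : ∀ u v → adj G u v ≡ true → (o u v ≡ true) ⊎ (o v u ≡ true)
    antisym : ∀ u v → o u v ≡ true → o v u ≡ false

Arc : {n : ℕ} → Orient n → Fin n → Fin n → Set
Arc o u v = o u v ≡ true

Acyclic : {n : ℕ} → Orient n → Set
Acyclic o = ∀ v → ¬ TransClosure (Arc o) v v

IsAcyclicOrientation : {n : ℕ} → SimpleGraph n → Orient n → Set
IsAcyclicOrientation G o = IsOrientation G o × Acyclic o

IsSource : {n : ℕ} → Orient n → Fin n → Set
IsSource o v = ∀ u → o u v ≡ false

IsSink : {n : ℕ} → Orient n → Fin n → Set
IsSink o w = ∀ u → o w u ≡ false

_≐_ : {n : ℕ} → Orient n → Orient n → Set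
o ≐ o' = ∀ u v → o u v ≡ o' u v

flip2 : {n : ℕ} → Orient n → Fin n → Fin n → Orient n
flip2 o v w x y =
  if ⌊ x ≟ v ⌋ ∨ ⌊ x ≟ w ⌋ ∨ ⌊ y ≟ v ⌋ ∨ ⌊ y ≟ w ⌋ then o y x else o x y

DoubleFlip : {n : ℕ} → SimpleGraph n → Orient n → Orient n → Set
DoubleFlip G o o' =
  IsAcyclicOrientation G o ×
  ∃[ v ] ∃[ w ] (v ≢ w × IsSource o v × IsSink o w × adj G v w ≡ false ×
                 o' ≐ flip2 o v w)

DFSteps : {n : ℕ} → SimpleGraph n → ℕ → Orient n → Orient n → Set
DFSteps G zero    o o'' = o ≐ o''
DFSteps G (suc k) o o'' = ∃[ o' ] (DoubleFlip G o o' × DFSteps G k o' o'')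

DFEquivalent : {n : ℕ} → SimpleGraph n → Orient n → Orient n → Set
DFEquivalent G o o'' = ∃[ k ] DFSteps G k o o''

ℕ→ℚ : ℕ → ℚ
ℕ→ℚ m = ℤ.+ m / 1

TendsToZero : (ℕ → ℚ) → Set
TendsToZero f = ∀ ε → 0ℚ < ε → ∃[ N ] (∀ m → N ℕ.≤ m → ∣ f m ∣ < ε)

-- Along a sequence of double flips from α to α'', let c v count how often v is
-- flipped from source to sink minus how often from sink to source. Then Σ c = 0,
-- and along every arc of α the value of c drops by 0 or by 1 according as α''
-- keeps or reverses that arc. Conversely, such a potential can be used up
-- greedily: a vertex of positive potential receiving no arc from another
-- positive vertex is a source, dually there is a sink of negative potential,
-- the two are nonadjacent, and double-flipping them lowers Σ |c| by 2.
-- Reducing c modulo 2n after a well chosen shift yields a potential with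
-- |c| ≤ 2n, so at most n · 2n ≤ 4n⁴ double flips are needed and the o(1) term
-- can be taken to be 0.

{-# OPTIONS --safe #-}
module Submission where

open import Defs renaming (sym to adj-sym)
open import Algebra.Bundles using (AbelianGroup)
open import Data.Bool using (Bool; true; false; _∨_; if_then_else_)
import Data.Bool.Properties as Boolₚ
open import Data.Empty using (⊥; ⊥-elim)
open import Data.Fin using (Fin; zero; suc; toℕ; _≟_)
import Data.Fin.Properties as Finₚ
open import Data.Integer as ℤ using (ℤ; +_; 0ℤ; 1ℤ)
open import Data.Integer.DivMod using (_%ℕ_; _/ℕ_; a≡a%ℕn+[a/ℕn]*n; n%ℕd<d)
import Data.Integer.Properties as ℤₚ
open import Data.Integer.Tactic.RingSolver using (solve-∀)
open import Data.Nat as ℕ using (ℕ; zero; suc; _^_) renaming (_*_ to _*ℕ_)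
import Data.Nat.Properties as ℕₚ
import Data.Nat.Tactic.RingSolver as ℕSolver
open import Data.Nat.Coprimality using (1-coprimeTo) renaming (sym to coprime-sym)
open import Data.Product using (Σ; Σ-syntax; ∃-syntax; _×_; _,_; proj₁; proj₂)
open import Data.Rational using (*≤*; _≤_; _+_; _*_; 1ℚ; 0ℚ)
import Data.Rational.Properties as ℚₚ
open import Data.Sum using (_⊎_; inj₁; inj₂)
open import Function using (_∘_; flip)
open import Relation.Binary.Construct.Closure.Transitive using (TransClosure; [_]; _∷_; _∷ʳ_)
open import Relation.Binary.Definitions using (Decidable; tri<; tri≈; tri>)
open import Relation.Binary.PropositionalEquality
open import Relation.Nullary using (¬_; Dec; yes; no)
open import Relation.Nullary.Decidable using (⌊_⌋; decidable-stable; _×-dec_; _→-dec_; ¬?)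
open import Relation.Unary using () renaming (Decidable to Decidable₁)
open import Algebra.Properties.Group (AbelianGroup.group ℤₚ.+-0-abelianGroup) using (∙-cancelʳ)
open import Algebra.Properties.Semiring.Sum ℤₚ.+-*-semiring
  using (sum; sum-cong-≗; sum-replicate-zero; *-distribʳ-sum)
import Algebra.Properties.Semiring.Sum ℕₚ.+-*-semiring as ℕΣ

private
  variable
    n : ℕ

-- Double flips

touches : Fin n → Fin n → Fin n → Bool
touches v w z = ⌊ z ≟ v ⌋ ∨ ⌊ z ≟ w ⌋

touches-left : (v w : Fin n) → touches v w v ≡ true
touches-left v w with v ≟ v
... | yes _ = refl
... | no v≢v = ⊥-elim (v≢v refl)

touches-right : (v w : Fin n) → touches v w w ≡ true
touches-right v w = trans (Boolₚ.∨-comm ⌊ w ≟ v ⌋ _) (touches-left w v)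

touches-other : {v w z : Fin n} → z ≢ v → z ≢ w → touches v w z ≡ false
touches-other {v = v} {w} {z} z≢v z≢w with z ≟ v | z ≟ w
... | yes z≡v | _      = ⊥-elim (z≢v z≡v)
... | no _    | yes z≡w = ⊥-elim (z≢w z≡w)
... | no _    | no _    = refl

touches-comm : (v w z : Fin n) → touches w v z ≡ touches v w z
touches-comm v w z = Boolₚ.∨-comm ⌊ z ≟ w ⌋ ⌊ z ≟ v ⌋

flip2-unfold : (o : Orient n) (v w x y : Fin n) →
  flip2 o v w x y ≡ (if touches v w x ∨ touches v w y then o y x else o x y)
flip2-unfold o v w x y = cong (λ b → if b then o y x else o x y)
  (sym (Boolₚ.∨-assoc ⌊ x ≟ v ⌋ ⌊ x ≟ w ⌋ (⌊ y ≟ v ⌋ ∨ ⌊ y ≟ w ⌋)))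

flip2-untouched : (o : Orient n) {v w x y : Fin n} →
  x ≢ v → x ≢ w → y ≢ v → y ≢ w → flip2 o v w x y ≡ o x y
flip2-untouched o {v} {w} {x} {y} x≢v x≢w y≢v y≢w
  rewrite flip2-unfold o v w x y | touches-other x≢v x≢w | touches-other y≢v y≢w = refl

flip2-touchedˡ : (o : Orient n) {v w x : Fin n} (y : Fin n) →
  touches v w x ≡ true → flip2 o v w x y ≡ o y x
flip2-touchedˡ o {v} {w} {x} y tx rewrite flip2-unfold o v w x y | tx = refl

flip2-touchedʳ : (o : Orient n) {v w : Fin n} (x : Fin n) {y : Fin n} →
  touches v w y ≡ true → flip2 o v w x y ≡ o y x
flip2-touchedʳ o {v} {w} x {y} ty
  rewrite flip2-unfold o v w x y | ty | Boolₚ.∨-zeroʳ (touches v w x) = refl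

flip2-edge : (o : Orient n) (v w x y : Fin n) →
  (flip2 o v w x y ≡ o x y × flip2 o v w y x ≡ o y x) ⊎
  (flip2 o v w x y ≡ o y x × flip2 o v w y x ≡ o x y)
flip2-edge o v w x y
  rewrite flip2-unfold o v w x y | flip2-unfold o v w y x
        | Boolₚ.∨-comm (touches v w y) (touches v w x)
  with touches v w x ∨ touches v w y
... | true  = inj₂ (refl , refl)
... | false = inj₁ (refl , refl)

flip2-involutive : (o : Orient n) (v w : Fin n) → flip2 (flip2 o v w) w v ≐ o
flip2-involutive o v w x y
  rewrite flip2-unfold (flip2 o v w) w v x y | touches-comm v w x | touches-comm v w y
        | flip2-unfold o v w y x | flip2-unfold o v w x y
        | Boolₚ.∨-comm (touches v w y) (touches v w x)
  with touches v w x ∨ touches v w y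
... | true  = refl
... | false = refl

≡true⇒≢false : {b : Bool} → b ≡ true → b ≢ false
≡true⇒≢false refl ()

flip2-isOrientation : {G : SimpleGraph n} {o : Orient n} (v w : Fin n) →
  IsOrientation G o → IsOrientation G (flip2 o v w)
flip2-isOrientation {G = G} {o} v w oO = record
  { arc⇒adj = arc⇒adj′ ; adj⇒arc = adj⇒arc′ ; antisym = antisym′ }
  where
  open IsOrientation oO
  arc⇒adj′ : ∀ x y → flip2 o v w x y ≡ true → adj G x y ≡ true
  arc⇒adj′ x y a with flip2-edge o v w x y
  ... | inj₁ (kept , _)     = arc⇒adj x y (trans (sym kept) a)
  ... | inj₂ (reversed , _) = trans (adj-sym G x y) (arc⇒adj y x (trans (sym reversed) a))
  adj⇒arc′ : ∀ x y → adj G x y ≡ true → (flip2 o v w x y ≡ true) ⊎ (flip2 o v w y x ≡ true)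
  adj⇒arc′ x y e with flip2-edge o v w x y | adj⇒arc x y e
  ... | inj₁ (kxy , _)   | inj₁ a = inj₁ (trans kxy a)
  ... | inj₁ (_   , kyx) | inj₂ a = inj₂ (trans kyx a)
  ... | inj₂ (_   , ryx) | inj₁ a = inj₂ (trans ryx a)
  ... | inj₂ (rxy , _)   | inj₂ a = inj₁ (trans rxy a)
  antisym′ : ∀ x y → flip2 o v w x y ≡ true → flip2 o v w y x ≡ false
  antisym′ x y a with flip2-edge o v w x y
  ... | inj₁ (kxy , kyx) = trans kyx (antisym x y (trans (sym kxy) a))
  ... | inj₂ (rxy , ryx) = trans ryx (antisym y x (trans (sym rxy) a))

module _ (o : Orient n) {s t : Fin n} (src : IsSource o s) (snk : IsSink o t) where

  flip2-sink : IsSink (flip2 o s t) s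
  flip2-sink y = trans (flip2-touchedˡ o y (touches-left s t)) (src y)

  flip2-source : IsSource (flip2 o s t) t
  flip2-source x = trans (flip2-touchedʳ o x (touches-right s t)) (snk x)

  private
    start≢s : ∀ {a b} → TransClosure (Arc (flip2 o s t)) a b → a ≢ s
    start≢s [ a→ ]    refl = ≡true⇒≢false a→ (flip2-sink _)
    start≢s (a→ ∷ _) refl = ≡true⇒≢false a→ (flip2-sink _)

    end≢t : ∀ {a b} → TransClosure (Arc (flip2 o s t)) a b → b ≢ t
    end≢t [ →b ]      refl = ≡true⇒≢false →b (flip2-source _)
    end≢t (_ ∷ rest) = end≢t rest

  -- Once s is a sink and t a source, a walk can only pass through s or t at
  -- its ends, so every interior arc is one that the flip left unchanged.
  flip2-walk : ∀ {a b} → a ≢ t → b ≢ s →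
    TransClosure (Arc (flip2 o s t)) a b → TransClosure (Arc o) a b
  flip2-walk a≢t b≢s [ a→b ] =
    [ trans (sym (flip2-untouched o (start≢s [ a→b ]) a≢t b≢s (end≢t [ a→b ]))) a→b ]
  flip2-walk a≢t b≢s (a→c ∷ rest) =
    trans (sym (flip2-untouched o (start≢s [ a→c ]) a≢t (start≢s rest) (end≢t [ a→c ]))) a→c
      ∷ flip2-walk (end≢t [ a→c ]) b≢s rest

  flip2-acyclic : Acyclic o → Acyclic (flip2 o s t)
  flip2-acyclic acyclic a cycle = acyclic a (flip2-walk (end≢t cycle) (start≢s cycle) cycle)

∃∀¬⊎∀∃ : ∀ {m} {Q : Fin m → Fin n → Set} → (∀ i j → Dec (Q i j)) →
  (∃[ i ] ∀ j → ¬ Q i j) ⊎ (∀ i → ∃[ j ] Q i j)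
∃∀¬⊎∀∃ {n = n} {Q = Q} Q? with Finₚ.any? (λ i → Finₚ.all? (λ j → ¬? (Q? i j)))
... | yes found = inj₁ found
... | no none = inj₂ witness
  where
  witness : ∀ i → ∃[ j ] Q i j
  witness i with Finₚ.all? (λ j → ¬? (Q? i j))
  ... | yes ¬Qi = ⊥-elim (none (i , ¬Qi))
  ... | no ¬all with Finₚ.¬∀⟶∃¬ n _ (λ j → ¬? (Q? i j)) ¬all
  ...   | j , ¬¬Qij = j , decidable-stable (Q? i j) ¬¬Qij

reverse⁺ : {A : Set} {R : A → A → Set} {a b : A} → TransClosure (flip R) a b → TransClosure R b a
reverse⁺ [ r ]        = [ r ]
reverse⁺ (r ∷ rest) = reverse⁺ rest ∷ʳ r

module _ {R : Fin n → Fin n → Set} (R? : Decidable R) (acyclic : ∀ v → ¬ TransClosure R v v)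
         {P : Fin n → Set} (P? : Decidable₁ P) where

  -- Without a minimal element every point of P has a predecessor in P; descending
  -- n steps visits n + 1 points, two of which coincide and close a cycle.
  acyclic⇒minimal : ∀ {p} → P p → ∃[ s ] (P s × ∀ x → P x → ¬ R x s)
  acyclic⇒minimal {p} Pp with ∃∀¬⊎∀∃ (λ s x → P? s →-dec (P? x ×-dec R? x s))
  ... | inj₁ (s , minimal) =
    s , decidable-stable (P? s) (λ ¬Ps → minimal s (λ Ps → ⊥-elim (¬Ps Ps))) ,
    λ x Px Rxs → minimal x (λ _ → Px , Rxs)
  ... | inj₂ has-predecessor = ⊥-elim cycle
    where
    predecessor : ∀ s → P s → Σ[ x ∈ Fin n ] (P x × R x s)
    predecessor s Ps = let x , PxRxs = has-predecessor s in x , PxRxs Ps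

    descent : ℕ → Σ (Fin n) P
    descent zero    = p , Pp
    descent (suc i) = let x , Px , _ = predecessor (proj₁ (descent i)) (proj₂ (descent i)) in x , Px

    point : ℕ → Fin n
    point i = proj₁ (descent i)

    descent-step : ∀ i → R (point (suc i)) (point i)
    descent-step i = proj₂ (proj₂ (predecessor (proj₁ (descent i)) (proj₂ (descent i))))

    descent-chain : ∀ {i j} → i ℕ.<′ j → TransClosure R (point j) (point i)
    descent-chain {i}         ℕ.≤′-refl       = [ descent-step i ]
    descent-chain {j = suc j} (ℕ.≤′-step i<j) = descent-step j ∷ descent-chain i<j

    cycle : ⊥
    cycle with Finₚ.pigeonhole (ℕₚ.n<1+n n) (λ (i : Fin (suc n)) → point (toℕ i))
    ... | i , j , i<j , same =
      acyclic (point (toℕ i))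
        (subst (λ x → TransClosure R x (point (toℕ i))) (sym same)
          (descent-chain (ℕₚ.<⇒<′ i<j)))

sum-distrib-+ : (f g : Fin n → ℤ) → sum (λ i → f i ℤ.+ g i) ≡ sum f ℤ.+ sum g
sum-distrib-+ {zero}  f g = refl
sum-distrib-+ {suc n} f g
  rewrite sum-distrib-+ (f ∘ suc) (g ∘ suc) = lemma (f zero) (g zero) _ _
  where lemma : ∀ a b c d → (a ℤ.+ b) ℤ.+ (c ℤ.+ d) ≡ (a ℤ.+ c) ℤ.+ (b ℤ.+ d)
        lemma = solve-∀

sum-neg : (f : Fin n → ℤ) → sum (λ i → ℤ.- f i) ≡ ℤ.- sum f
sum-neg {zero}  f = refl
sum-neg {suc n} f rewrite sum-neg (f ∘ suc) = sym (ℤₚ.neg-distrib-+ (f zero) _)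

sum-const : ∀ n (a : ℤ) → sum {n} (λ _ → a) ≡ + n ℤ.* a
sum-const zero    a = refl
sum-const (suc n) a rewrite sum-const n a = lemma a (+ n)
  where lemma : ∀ a m → a ℤ.+ m ℤ.* a ≡ (1ℤ ℤ.+ m) ℤ.* a
        lemma = solve-∀

δ : Fin n → Fin n → ℤ
δ zero    zero    = 1ℤ
δ zero    (suc _) = 0ℤ
δ (suc _) zero    = 0ℤ
δ (suc v) (suc z) = δ v z

δ-diag : (v : Fin n) → δ v v ≡ 1ℤ
δ-diag zero    = refl
δ-diag (suc v) = δ-diag v

δ-off : {v z : Fin n} → z ≢ v → δ v z ≡ 0ℤ
δ-off {v = zero}  {zero}  z≢v = ⊥-elim (z≢v refl)
δ-off {v = zero}  {suc z} z≢v = refl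
δ-off {v = suc v} {zero}  z≢v = refl
δ-off {v = suc v} {suc z} z≢v = δ-off (z≢v ∘ cong suc)

sum-δ : (v : Fin n) → sum (δ v) ≡ 1ℤ
sum-δ {suc n} zero    = cong (λ s → 1ℤ ℤ.+ s) (sum-replicate-zero n)
sum-δ {suc n} (suc v) = trans (ℤₚ.+-identityˡ _) (sum-δ v)

nonpos-+-≡0 : {a b : ℤ} → a ℤ.≤ 0ℤ → b ℤ.≤ 0ℤ → a ℤ.+ b ≡ 0ℤ → a ≡ 0ℤ
nonpos-+-≡0 {a} {b} a≤0 b≤0 a+b≡0 = ℤₚ.≤-antisym a≤0 (begin
  0ℤ         ≡⟨ sym a+b≡0 ⟩
  a ℤ.+ b    ≤⟨ ℤₚ.+-monoʳ-≤ a b≤0 ⟩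
  a ℤ.+ 0ℤ   ≡⟨ ℤₚ.+-identityʳ a ⟩
  a          ∎)
  where open ℤₚ.≤-Reasoning

sum-nonpos : (f : Fin n → ℤ) → (∀ i → f i ℤ.≤ 0ℤ) → sum f ℤ.≤ 0ℤ
sum-nonpos {zero}  f f≤0 = ℤₚ.≤-refl
sum-nonpos {suc n} f f≤0 = ℤₚ.+-mono-≤ (f≤0 zero) (sum-nonpos (f ∘ suc) (f≤0 ∘ suc))

sum-nonpos-≡0 : (f : Fin n → ℤ) → (∀ i → f i ℤ.≤ 0ℤ) → sum f ≡ 0ℤ → ∀ i → f i ≡ 0ℤ
sum-nonpos-≡0 {suc n} f f≤0 Σf≡0 zero =
  nonpos-+-≡0 (f≤0 zero) (sum-nonpos (f ∘ suc) (f≤0 ∘ suc)) Σf≡0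
sum-nonpos-≡0 {suc n} f f≤0 Σf≡0 (suc i) =
  sum-nonpos-≡0 (f ∘ suc) (f≤0 ∘ suc)
    (nonpos-+-≡0 (sum-nonpos (f ∘ suc) (f≤0 ∘ suc)) (f≤0 zero)
      (trans (ℤₚ.+-comm _ (f zero)) Σf≡0)) i

sum≡0⇒∃pos : (f : Fin n → ℤ) → sum f ≡ 0ℤ → {i : Fin n} → f i ≢ 0ℤ →
  ∃[ j ] (0ℤ ℤ.< f j)
sum≡0⇒∃pos f Σf≡0 {i} fi≢0 with Finₚ.any? (λ j → 0ℤ ℤₚ.<? f j)
... | yes pos = pos
... | no ¬pos =
  ⊥-elim (fi≢0 (sum-nonpos-≡0 f (λ j → ℤₚ.≮⇒≥ (λ 0<fj → ¬pos (j , 0<fj))) Σf≡0 i))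

sum≡0⇒∃neg : (f : Fin n → ℤ) → sum f ≡ 0ℤ → {i : Fin n} → f i ≢ 0ℤ →
  ∃[ j ] (f j ℤ.< 0ℤ)
sum≡0⇒∃neg f Σf≡0 {i} fi≢0
  with sum≡0⇒∃pos (ℤ.-_ ∘ f) (trans (sum-neg f) (cong ℤ.-_ Σf≡0)) (fi≢0 ∘ ℤₚ.neg-injective)
... | j , 0<-fj = j , ℤₚ.neg-cancel-< 0<-fj

sum≡0⇒∃≤0 : (f : Fin (suc n) → ℤ) → sum f ≡ 0ℤ → ∃[ i ] (f i ℤ.≤ 0ℤ)
sum≡0⇒∃≤0 f Σf≡0 with f zero ℤₚ.≤? 0ℤ
... | yes f0≤0 = zero , f0≤0
... | no f0≰0 with sum≡0⇒∃neg f Σf≡0 {zero} (f0≰0 ∘ ℤₚ.≤-reflexive)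
...   | j , fj<0 = j , ℤₚ.<⇒≤ fj<0

sum≡0⇒∃≥0 : (f : Fin (suc n) → ℤ) → sum f ≡ 0ℤ → ∃[ i ] (0ℤ ℤ.≤ f i)
sum≡0⇒∃≥0 f Σf≡0 with 0ℤ ℤₚ.≤? f zero
... | yes 0≤f0 = zero , 0≤f0
... | no 0≰f0 with sum≡0⇒∃pos f Σf≡0 {zero} (0≰f0 ∘ ℤₚ.≤-reflexive ∘ sym)
...   | j , 0<fj = j , ℤₚ.<⇒≤ 0<fj

sumℕ-mono-≤ : {f g : Fin n → ℕ} → (∀ i → f i ℕ.≤ g i) → ℕΣ.sum f ℕ.≤ ℕΣ.sum g
sumℕ-mono-≤ {zero}  f≤g = ℕ.z≤n
sumℕ-mono-≤ {suc n} f≤g = ℕₚ.+-mono-≤ (f≤g zero) (sumℕ-mono-≤ (f≤g ∘ suc))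

sumℕ-mono-< : {f g : Fin n → ℕ} → (∀ i → f i ℕ.≤ g i) → {i : Fin n} → f i ℕ.< g i →
  ℕΣ.sum f ℕ.< ℕΣ.sum g
sumℕ-mono-< f≤g {zero}  fi<gi = ℕₚ.+-mono-<-≤ fi<gi (sumℕ-mono-≤ (f≤g ∘ suc))
sumℕ-mono-< f≤g {suc i} fi<gi = ℕₚ.+-mono-≤-< (f≤g zero) (sumℕ-mono-< (f≤g ∘ suc) fi<gi)

sumℕ-≤-* : {f : Fin n → ℕ} (b : ℕ) → (∀ i → f i ℕ.≤ b) → ℕΣ.sum f ℕ.≤ n ℕ.* b
sumℕ-≤-* {zero}  b f≤b = ℕ.z≤n
sumℕ-≤-* {suc n} b f≤b = ℕₚ.+-mono-≤ (f≤b zero) (sumℕ-≤-* b (f≤b ∘ suc))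

-- The modulus is written suc k, so that its largest remainder is k.
module _ (k : ℕ) where

  private
    M = suc k

    remainder-bound : ∀ {r r′ : ℕ} (q q′ : ℤ) → r ℕ.< M → q ℤ.< q′ →
      + r ℤ.+ q ℤ.* + M ℤ.< + r′ ℤ.+ q′ ℤ.* + M
    remainder-bound {r} {r′} q q′ r<M q<q′ = begin-strict
      + r ℤ.+ q ℤ.* + M        <⟨ ℤₚ.+-monoˡ-< (q ℤ.* + M) (ℤ.+<+ r<M) ⟩
      + M ℤ.+ q ℤ.* + M        ≡⟨ lemma (+ M) q ⟩
      ℤ.suc q ℤ.* + M          ≤⟨ ℤₚ.*-monoʳ-≤-nonNeg (+ M) (ℤₚ.i<j⇒suc[i]≤j q<q′) ⟩
      q′ ℤ.* + M               ≤⟨ ℤₚ.i≤j+i (q′ ℤ.* + M) (+ r′) ⟩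
      + r′ ℤ.+ q′ ℤ.* + M      ∎
      where
      open ℤₚ.≤-Reasoning
      lemma : ∀ m q → m ℤ.+ q ℤ.* m ≡ (1ℤ ℤ.+ q) ℤ.* m
      lemma = solve-∀

  divModℕ-unique : ∀ {r r′ : ℕ} (q q′ : ℤ) → r ℕ.< M → r′ ℕ.< M →
    + r ℤ.+ q ℤ.* + M ≡ + r′ ℤ.+ q′ ℤ.* + M → r ≡ r′
  divModℕ-unique q q′ r<M r′<M e with ℤₚ.<-cmp q q′
  ... | tri< q<q′ _ _ = ⊥-elim (ℤₚ.<-irrefl e (remainder-bound q q′ r<M q<q′))
  ... | tri> _ _ q′<q = ⊥-elim (ℤₚ.<-irrefl (sym e) (remainder-bound q′ q r′<M q′<q))
  ... | tri≈ _ refl _ = ℤₚ.+-injective (∙-cancelʳ (q ℤ.* + M) _ _ e)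

  %ℕ-unique : ∀ (a : ℤ) {r : ℕ} (q : ℤ) → r ℕ.< M → a ≡ + r ℤ.+ q ℤ.* + M → a %ℕ M ≡ r
  %ℕ-unique a q r<M a≡ =
    divModℕ-unique (a /ℕ M) q (n%ℕd<d a M) r<M (trans (sym (a≡a%ℕn+[a/ℕn]*n a M)) a≡)

  %ℕ-suc : ∀ (a : ℤ) → a %ℕ M ≢ k → ℤ.suc a %ℕ M ≡ suc (a %ℕ M)
  %ℕ-suc a no-wrap = %ℕ-unique (ℤ.suc a) (a /ℕ M)
    (ℕ.s≤s (ℕₚ.≤∧≢⇒< (ℕₚ.<⇒≤pred (n%ℕd<d a M)) no-wrap))
    (trans (cong ℤ.suc (a≡a%ℕn+[a/ℕn]*n a M))
           (sym (ℤₚ.+-assoc 1ℤ (+ (a %ℕ M)) ((a /ℕ M) ℤ.* + M))))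

  %ℕ-top-unique : ∀ (a : ℤ) {I J : ℕ} → I ℕ.< J → J ℕ.< M →
    (a ℤ.+ + I) %ℕ M ≡ k → (a ℤ.+ + J) %ℕ M ≢ k
  %ℕ-top-unique a {I} {J} I<J J<M topI topJ = ℕₚ.<-irrefl (trans (sym remJ) topJ) gap<k
    where
    gap = J ℕ.∸ suc I
    J≡ : J ≡ suc gap ℕ.+ I
    J≡ = sym (trans (sym (ℕₚ.+-suc gap I)) (ℕₚ.m∸n+n≡m I<J))
    gap<k : gap ℕ.< k
    gap<k = ℕₚ.≤-<-trans (ℕₚ.m≤m+n gap I) (ℕ.s≤s⁻¹ (subst (ℕ._< M) J≡ J<M))
    q = (a ℤ.+ + I) /ℕ M
    remJ : (a ℤ.+ + J) %ℕ M ≡ gap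
    remJ = %ℕ-unique (a ℤ.+ + J) (1ℤ ℤ.+ q) (ℕₚ.<-trans gap<k (ℕₚ.n<1+n k)) (begin
      a ℤ.+ + J
        ≡⟨ cong (λ j → a ℤ.+ + j) J≡ ⟩
      a ℤ.+ + (suc gap ℕ.+ I)
        ≡⟨ cong (λ x → a ℤ.+ x) (ℤₚ.pos-+ (suc gap) I) ⟩
      a ℤ.+ (+ suc gap ℤ.+ + I)
        ≡⟨ lemma a (+ gap) (+ I) ⟩
      (a ℤ.+ + I) ℤ.+ (1ℤ ℤ.+ + gap)
        ≡⟨ cong (ℤ._+ (1ℤ ℤ.+ + gap)) (a≡a%ℕn+[a/ℕn]*n (a ℤ.+ + I) M) ⟩
      (+ ((a ℤ.+ + I) %ℕ M) ℤ.+ q ℤ.* + M) ℤ.+ (1ℤ ℤ.+ + gap)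
        ≡⟨ cong (λ r → (+ r ℤ.+ q ℤ.* + M) ℤ.+ (1ℤ ℤ.+ + gap)) topI ⟩
      (+ k ℤ.+ q ℤ.* (1ℤ ℤ.+ + k)) ℤ.+ (1ℤ ℤ.+ + gap)
        ≡⟨ lemma′ (+ k) q (+ gap) ⟩
      + gap ℤ.+ (1ℤ ℤ.+ q) ℤ.* (1ℤ ℤ.+ + k) ∎)
      where
      open ≡-Reasoning
      lemma : ∀ a g i → a ℤ.+ ((1ℤ ℤ.+ g) ℤ.+ i) ≡ (a ℤ.+ i) ℤ.+ (1ℤ ℤ.+ g)
      lemma = solve-∀
      lemma′ : ∀ k q g →
        (k ℤ.+ q ℤ.* (1ℤ ℤ.+ k)) ℤ.+ (1ℤ ℤ.+ g) ≡ g ℤ.+ (1ℤ ℤ.+ q) ℤ.* (1ℤ ℤ.+ k)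
      lemma′ = solve-∀

-- Each v hits the top remainder for only one shift below suc k, and there are more
-- shifts than vertices.
∃-shift-avoiding-top : (k : ℕ) → n ℕ.< suc k → (a : Fin n → ℤ) →
  ∃[ K ] ∀ v → (a v ℤ.+ + K) %ℕ suc k ≢ k
∃-shift-avoiding-top k n<1+k a
  with ∃∀¬⊎∀∃ (λ (K : Fin (suc k)) v → (a v ℤ.+ + toℕ K) %ℕ suc k ℕₚ.≟ k)
... | inj₁ (K , avoid) = toℕ K , avoid
... | inj₂ hits with Finₚ.pigeonhole n<1+k (proj₁ ∘ hits)
...   | I , J , I<J , same = ⊥-elim (%ℕ-top-unique k (a v) I<J (Finₚ.toℕ<n J) (proj₂ (hits I))
        (subst (λ u → (a u ℤ.+ + toℕ J) %ℕ suc k ≡ k) (sym same) (proj₂ (hits J))))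
  where v = proj₁ (hits I)

-- Potentials

Compatible : Orient n → (Fin n → ℤ) → Fin n → Fin n → Set
Compatible γ c u x = (c u ≡ c x × Arc γ u x) ⊎ (c u ≡ ℤ.suc (c x) × Arc γ x u)

Potential : Orient n → Orient n → (Fin n → ℤ) → Set
Potential γ o c = ∀ u x → Arc o u x → Compatible γ c u x

module _ {γ : Orient n} {c c′ : Fin n → ℤ} where

  compatible-resp : ∀ {u x} → c′ u ≡ c u → c′ x ≡ c x →
    Compatible γ c u x → Compatible γ c′ u x
  compatible-resp eu ex (inj₁ (e , kept))     = inj₁ (trans eu (trans e (sym ex)) , kept)
  compatible-resp eu ex (inj₂ (e , reversed)) =
    inj₂ (trans eu (trans e (cong ℤ.suc (sym ex))) , reversed)

  compatible-reverse : ∀ {x y} →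
    (c x ≡ c y → c′ y ≡ ℤ.suc (c′ x)) → (c x ≡ ℤ.suc (c y) → c′ y ≡ c′ x) →
    Compatible γ c x y → Compatible γ c′ y x
  compatible-reverse level _    (inj₁ (e , kept))     = inj₂ (level e , kept)
  compatible-reverse _    drop (inj₂ (e , reversed)) = inj₁ (drop e , reversed)

bump : (Fin n → ℤ) → Fin n → Fin n → Fin n → ℤ
bump c v w z = c z ℤ.+ (δ v z ℤ.- δ w z)

module _ (c : Fin n → ℤ) {v w : Fin n} where

  bump-source : v ≢ w → bump c v w v ≡ ℤ.suc (c v)
  bump-source v≢w rewrite δ-diag v | δ-off v≢w = lemma (c v)
    where lemma : ∀ a → a ℤ.+ (1ℤ ℤ.- 0ℤ) ≡ 1ℤ ℤ.+ a
          lemma = solve-∀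

  bump-sink : v ≢ w → bump c v w w ≡ ℤ.pred (c w)
  bump-sink v≢w rewrite δ-diag w | δ-off (v≢w ∘ sym) = lemma (c w)
    where lemma : ∀ a → a ℤ.+ (0ℤ ℤ.- 1ℤ) ≡ ℤ.-1ℤ ℤ.+ a
          lemma = solve-∀

  bump-other : ∀ {z} → z ≢ v → z ≢ w → bump c v w z ≡ c z
  bump-other z≢v z≢w rewrite δ-off z≢v | δ-off z≢w = ℤₚ.+-identityʳ _

  sum-bump : sum (bump c v w) ≡ sum c
  sum-bump = begin
    sum (λ z → c z ℤ.+ (δ v z ℤ.- δ w z))
      ≡⟨ sum-distrib-+ c _ ⟩
    sum c ℤ.+ sum (λ z → δ v z ℤ.+ ℤ.- δ w z)
      ≡⟨ cong (λ s → sum c ℤ.+ s) (sum-distrib-+ (δ v) _) ⟩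
    sum c ℤ.+ (sum (δ v) ℤ.+ sum (λ z → ℤ.- δ w z))
      ≡⟨ cong (λ s → sum c ℤ.+ (sum (δ v) ℤ.+ s)) (sum-neg (δ w)) ⟩
    sum c ℤ.+ (sum (δ v) ℤ.- sum (δ w))
      ≡⟨ cong₂ (λ a b → sum c ℤ.+ (a ℤ.- b)) (sum-δ v) (sum-δ w) ⟩
    sum c ℤ.+ 0ℤ
      ≡⟨ ℤₚ.+-identityʳ (sum c) ⟩
    sum c ∎
    where open ≡-Reasoning

module _ {G : SimpleGraph n} {γ o o′ : Orient n} {v w : Fin n}
         (oO : IsOrientation G o) (v≢w : v ≢ w) (src : IsSource o v) (snk : IsSink o w)
         (v≁w : adj G v w ≡ false) (o′≐ : o′ ≐ flip2 o v w) (c : Fin n → ℤ) where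

  private
    c′ = bump c v w

    head≢w : ∀ {u x} → Arc o u x → u ≢ w
    head≢w a refl = ≡true⇒≢false a (snk _)

    tail≢v : ∀ {u x} → Arc o u x → x ≢ v
    tail≢v a refl = ≡true⇒≢false a (src _)

    from-source : ∀ x → Arc o v x → Compatible γ c x v → Compatible γ c′ v x
    from-source x a = compatible-reverse {γ = γ}
      (λ cx≡cv → begin
        c′ v         ≡⟨ bump-source c v≢w ⟩
        ℤ.suc (c v)  ≡⟨ cong ℤ.suc (sym cx≡cv) ⟩
        ℤ.suc (c x)  ≡⟨ cong ℤ.suc (sym c′x≡cx) ⟩
        ℤ.suc (c′ x) ∎)
      (λ cx≡1+cv → begin
        c′ v         ≡⟨ bump-source c v≢w ⟩
        ℤ.suc (c v)  ≡⟨ sym cx≡1+cv ⟩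
        c x          ≡⟨ sym c′x≡cx ⟩
        c′ x         ∎)
      where
      open ≡-Reasoning
      x≢w : x ≢ w
      x≢w refl = ≡true⇒≢false (IsOrientation.arc⇒adj oO v w a) v≁w
      c′x≡cx : c′ x ≡ c x
      c′x≡cx = bump-other c (tail≢v a) x≢w

    into-sink : ∀ u → u ≢ v → Arc o u w → Compatible γ c w u → Compatible γ c′ u w
    into-sink u u≢v a = compatible-reverse {γ = γ}
      (λ cw≡cu → begin
        c′ u                  ≡⟨ c′u≡cu ⟩
        c u                   ≡⟨ sym cw≡cu ⟩
        c w                   ≡⟨ sym (ℤₚ.suc-pred (c w)) ⟩
        ℤ.suc (ℤ.pred (c w))  ≡⟨ cong ℤ.suc (sym (bump-sink c v≢w)) ⟩
        ℤ.suc (c′ w)          ∎)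
      (λ cw≡1+cu → begin
        c′ u                  ≡⟨ c′u≡cu ⟩
        c u                   ≡⟨ sym (ℤₚ.pred-suc (c u)) ⟩
        ℤ.pred (ℤ.suc (c u))  ≡⟨ cong ℤ.pred (sym cw≡1+cu) ⟩
        ℤ.pred (c w)          ≡⟨ sym (bump-sink c v≢w) ⟩
        c′ w                  ∎)
      where
      open ≡-Reasoning
      c′u≡cu : c′ u ≡ c u
      c′u≡cu = bump-other c u≢v (head≢w a)

  potential-unflip : Potential γ o′ c → Potential γ o (bump c v w)
  potential-unflip pot u x a with u ≟ v | x ≟ w
  ... | yes refl | _ = from-source x a (pot x v o′xv)
    where o′xv = trans (o′≐ x v) (trans (flip2-touchedʳ o x (touches-left v w)) a)
  ... | no u≢v | yes refl = into-sink u u≢v a (pot w u o′wu)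
    where o′wu = trans (o′≐ w u) (trans (flip2-touchedˡ o u (touches-right v w)) a)
  ... | no u≢v | no x≢w =
    compatible-resp {γ = γ} (bump-other c u≢v (head≢w a)) (bump-other c (tail≢v a) x≢w) (pot u x o′ux)
    where o′ux = trans (o′≐ u x) (trans (flip2-untouched o u≢v (head≢w a) (tail≢v a) x≢w) a)

potential-of-path : {G : SimpleGraph n} {γ : Orient n} (k : ℕ) {α : Orient n} → DFSteps G k α γ →
  ∃[ c ] (Potential γ α c × sum c ≡ 0ℤ)
potential-of-path {n = n} zero α≐γ =
  (λ _ → 0ℤ) , (λ u x a → inj₁ (refl , trans (sym (α≐γ u x)) a)) , sum-replicate-zero n
potential-of-path (suc k) (β , (Aα , v , w , v≢w , src , snk , v≁w , β≐) , rest)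
  with potential-of-path k rest
... | c , pot , Σc≡0 =
  bump c v w , potential-unflip (proj₁ Aα) v≢w src snk v≁w β≐ c pot , trans (sum-bump c {v} {w}) Σc≡0

potential-const⇒≐ : {G : SimpleGraph n} {γ o : Orient n} {c : Fin n → ℤ} →
  IsOrientation G γ → IsOrientation G o → Potential γ o c → (∀ u x → c u ≡ c x) → o ≐ γ
potential-const⇒≐ {γ = γ} {o} {c} γO oO pot const u x with o u x in oux
... | true with pot u x oux
...   | inj₁ (_ , kept)       = sym kept
...   | inj₂ (cu≡1+cx , _)    = ⊥-elim (ℤₚ.i≢suc[i] (trans (sym (const u x)) cu≡1+cx))
potential-const⇒≐ {γ = γ} {o} {c} γO oO pot const u x | false with γ u x in γux
...   | false = refl
...   | true with IsOrientation.adj⇒arc oO u x (IsOrientation.arc⇒adj γO u x γux)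
...     | inj₁ oux′ = ⊥-elim (≡true⇒≢false oux′ oux)
...     | inj₂ oxu with pot x u oxu
...       | inj₁ (_ , γxu)     = ⊥-elim (≡true⇒≢false γxu (IsOrientation.antisym γO u x γux))
...       | inj₂ (cx≡1+cu , _) = ⊥-elim (ℤₚ.i≢suc[i] (trans (sym (const x u)) cx≡1+cu))

potential-map : {γ o : Orient n} {c : Fin n → ℤ} (φ : ℤ → ℤ) →
  (∀ v → φ (ℤ.suc (c v)) ≡ ℤ.suc (φ (c v))) → Potential γ o c → Potential γ o (φ ∘ c)
potential-map φ φ-suc pot u x a with pot u x a
... | inj₁ (e , kept)     = inj₁ (cong φ e , kept)
... | inj₂ (e , reversed) = inj₂ (trans (cong φ e) (φ-suc x) , reversed)

-- Greedy descent

∣pred[i]∣<∣i∣ : ∀ i → 0ℤ ℤ.< i → ℤ.∣ ℤ.pred i ∣ ℕ.< ℤ.∣ i ∣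
∣pred[i]∣<∣i∣ (ℤ.+ zero)  (ℤ.+<+ ())
∣pred[i]∣<∣i∣ (ℤ.+ suc m) _ =
  subst (λ j → ℤ.∣ j ∣ ℕ.< suc m) (sym (ℤₚ.pred-suc (+ m))) (ℕₚ.n<1+n m)

∣suc[i]∣<∣i∣ : ∀ i → i ℤ.< 0ℤ → ℤ.∣ ℤ.suc i ∣ ℕ.< ℤ.∣ i ∣
∣suc[i]∣<∣i∣ ℤ.-[1+ zero  ] _ = ℕ.s≤s ℕ.z≤n
∣suc[i]∣<∣i∣ ℤ.-[1+ suc m ] _ = ℕₚ.n<1+n (suc m)
∣suc[i]∣<∣i∣ (ℤ.+ m)        (ℤ.+<+ ())

module _ {γ β : Orient n} {d : Fin n → ℤ} (pot : Potential γ β d) (h : ℤ) where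

  source-above : ∀ {s} → h ℤ.< d s → (∀ x → h ℤ.< d x → ¬ Arc β x s) → IsSource β s
  source-above {s} h<ds minimal x with β x s in x→s
  ... | false = refl
  ... | true with pot x s x→s
  ...   | inj₁ (dx≡ds , _)   = ⊥-elim (minimal x (subst (h ℤ.<_) (sym dx≡ds) h<ds) x→s)
  ...   | inj₂ (dx≡1+ds , _) = ⊥-elim (minimal x
            (subst (h ℤ.<_) (sym dx≡1+ds) (ℤₚ.<-≤-trans h<ds (ℤₚ.i≤suc[i] (d s)))) x→s)

  sink-below : ∀ {t} → d t ℤ.< h → (∀ x → d x ℤ.< h → ¬ Arc β t x) → IsSink β t
  sink-below {t} dt<h maximal x with β t x in t→x
  ... | false = refl
  ... | true with pot t x t→x
  ...   | inj₁ (dt≡dx , _)   = ⊥-elim (maximal x (subst (ℤ._< h) dt≡dx dt<h) t→x)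
  ...   | inj₂ (dt≡1+dx , _) = ⊥-elim (maximal x
            (ℤₚ.≤-<-trans (ℤₚ.i≤suc[i] (d x)) (subst (ℤ._< h) dt≡1+dx dt<h)) t→x)

potential-gap⇒nonadjacent : {G : SimpleGraph n} {γ β : Orient n} {d : Fin n → ℤ} {s t : Fin n} →
  IsOrientation G β → Potential γ β d → IsSink β t → ℤ.suc (d t) ℤ.< d s → adj G s t ≡ false
potential-gap⇒nonadjacent {G = G} {β = β} {d} {s} {t} βO pot snk gap with adj G s t in s~t
... | false = refl
... | true with IsOrientation.adj⇒arc βO s t s~t
...   | inj₂ t→s = ⊥-elim (≡true⇒≢false t→s (snk s))
...   | inj₁ s→t with pot s t s→t
...     | inj₁ (ds≡dt , _)   =
  ⊥-elim (ℤₚ.<⇒≱ gap (subst (ℤ._≤ ℤ.suc (d t)) (sym ds≡dt) (ℤₚ.i≤suc[i] (d t))))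
...     | inj₂ (ds≡1+dt , _) = ⊥-elim (ℤₚ.<-irrefl (sym ds≡1+dt) gap)

module Descent {G : SimpleGraph n} {γ : Orient n} (γO : IsOrientation G γ) where

  μ : (Fin n → ℤ) → ℕ
  μ d = ℕΣ.sum (λ v → ℤ.∣ d v ∣)

  BalancedPotential : Orient n → (Fin n → ℤ) → Set
  BalancedPotential β d = IsAcyclicOrientation G β × Potential γ β d × sum d ≡ 0ℤ

  μ-bump< : (d : Fin n → ℤ) {t s : Fin n} → t ≢ s → d t ℤ.< 0ℤ → 0ℤ ℤ.< d s →
    μ (bump d t s) ℕ.< μ d
  μ-bump< d {t} {s} t≢s dt<0 0<ds = sumℕ-mono-< pointwise at-s
    where
    at-s : ℤ.∣ bump d t s s ∣ ℕ.< ℤ.∣ d s ∣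
    at-s = subst (λ i → ℤ.∣ i ∣ ℕ.< ℤ.∣ d s ∣) (sym (bump-sink d t≢s))
      (∣pred[i]∣<∣i∣ (d s) 0<ds)
    at-t : ℤ.∣ bump d t s t ∣ ℕ.< ℤ.∣ d t ∣
    at-t = subst (λ i → ℤ.∣ i ∣ ℕ.< ℤ.∣ d t ∣) (sym (bump-source d t≢s))
      (∣suc[i]∣<∣i∣ (d t) dt<0)
    pointwise : ∀ z → ℤ.∣ bump d t s z ∣ ℕ.≤ ℤ.∣ d z ∣
    pointwise z with z ≟ t | z ≟ s
    ... | yes refl | _        = ℕₚ.<⇒≤ at-t
    ... | no _     | yes refl = ℕₚ.<⇒≤ at-s
    ... | no z≢t   | no z≢s   = ℕₚ.≤-reflexive (cong ℤ.∣_∣ (bump-other d z≢t z≢s))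

  source-sink-pair : ∀ {β d} → BalancedPotential β d → ∀ {i} → d i ≢ 0ℤ →
    ∃[ s ] ∃[ t ] (IsSource β s × IsSink β t × 0ℤ ℤ.< d s × d t ℤ.< 0ℤ)
  source-sink-pair {β} {d} ((_ , βacyclic) , pot , Σd≡0) di≢0 =
    s , t , source-above pot 0ℤ 0<ds s-minimal , sink-below pot 0ℤ dt<0 t-maximal , 0<ds , dt<0
    where
    Arc? : Decidable (Arc β)
    Arc? x y = β x y Boolₚ.≟ true
    top = acyclic⇒minimal Arc? βacyclic (λ x → 0ℤ ℤₚ.<? d x) (proj₂ (sum≡0⇒∃pos d Σd≡0 di≢0))
    bottom = acyclic⇒minimal (flip Arc?) (λ v → βacyclic v ∘ reverse⁺) (λ x → d x ℤₚ.<? 0ℤ)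
      (proj₂ (sum≡0⇒∃neg d Σd≡0 di≢0))
    s = proj₁ top
    0<ds = proj₁ (proj₂ top)
    s-minimal = proj₂ (proj₂ top)
    t = proj₁ bottom
    dt<0 = proj₁ (proj₂ bottom)
    t-maximal = proj₂ (proj₂ bottom)

  descent-step : ∀ {β d} → BalancedPotential β d → ∀ {i} → d i ≢ 0ℤ →
    ∃[ β′ ] ∃[ d′ ] (DoubleFlip G β β′ × BalancedPotential β′ d′ × μ d′ ℕ.< μ d)
  descent-step {β} {d} bal@(Aβ@(βO , βacyclic) , pot , Σd≡0) di≢0
    with source-sink-pair bal di≢0
  ... | s , t , src , snk , 0<ds , dt<0 =
    flip2 β s t , bump d t s ,
    (Aβ , s , t , s≢t , src , snk , s≁t , λ _ _ → refl) ,
    ((β′O , flip2-acyclic β src snk βacyclic) , pot′ , trans (sum-bump d {t} {s}) Σd≡0) ,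
    μ-bump< d (s≢t ∘ sym) dt<0 0<ds
    where
    s≢t : s ≢ t
    s≢t refl = ℤₚ.<-asym 0<ds dt<0
    s≁t : adj G s t ≡ false
    s≁t = potential-gap⇒nonadjacent βO pot snk (ℤₚ.≤-<-trans (ℤₚ.i<j⇒suc[i]≤j dt<0) 0<ds)
    β′O : IsOrientation G (flip2 β s t)
    β′O = flip2-isOrientation s t βO
    pot′ : Potential γ (flip2 β s t) (bump d t s)
    pot′ = potential-unflip β′O (s≢t ∘ sym) (flip2-source β src snk) (flip2-sink β src snk)
      (trans (adj-sym G t s) s≁t) (λ x y → sym (flip2-involutive β s t x y)) d pot

  settled-or-step : ∀ {β d} → BalancedPotential β d →
    β ≐ γ ⊎ ∃[ β′ ] ∃[ d′ ] (DoubleFlip G β β′ × BalancedPotential β′ d′ × μ d′ ℕ.< μ d)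
  settled-or-step {d = d} bal@((βO , _) , pot , _) with Finₚ.all? (λ v → d v ℤₚ.≟ 0ℤ)
  ... | yes d≡0 = inj₁ (potential-const⇒≐ γO βO pot (λ u x → trans (d≡0 u) (sym (d≡0 x))))
  ... | no d≢0 with Finₚ.¬∀⟶∃¬ n _ (λ v → d v ℤₚ.≟ 0ℤ) d≢0
  ...   | _ , di≢0 = inj₂ (descent-step bal di≢0)

  descend : ∀ b {β d} → BalancedPotential β d → μ d ℕ.≤ b →
    ∃[ k ] (k ℕ.≤ μ d × DFSteps G k β γ)
  descend b bal μd≤b with settled-or-step bal
  ... | inj₁ β≐γ = 0 , ℕ.z≤n , β≐γ
  ... | inj₂ (β′ , d′ , step , bal′ , μd′<μd) with b
  ...   | zero = ⊥-elim (ℕₚ.n≮0 (ℕₚ.<-≤-trans μd′<μd μd≤b))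
  ...   | suc b′ with descend b′ bal′ (ℕₚ.≤-pred (ℕₚ.<-≤-trans μd′<μd μd≤b))
  ...     | k , k≤μd′ , steps = suc k , ℕₚ.≤-trans (ℕ.s≤s k≤μd′) μd′<μd , β′ , step , steps

-- Normalisation

-- Reducing c + K modulo 2n keeps every drop of 1 along an arc as long as no value
-- sits at the top remainder. The offset 2Q restores the zero sum, because the
-- reduction subtracts Q·2n in total.
normalize-shifted : ∀ {m} {γ o : Orient (suc m)} (c : Fin (suc m) → ℤ) →
  Potential γ o c → sum c ≡ 0ℤ →
  (K : ℕ) → (∀ v → (c v ℤ.+ + K) %ℕ (suc m ℕ.+ suc m) ≢ m ℕ.+ suc m) →
  ∃[ d ] (Potential γ o d × sum d ≡ 0ℤ × ∀ v → ℤ.∣ d v ∣ ℕ.≤ suc m ℕ.+ suc m)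
normalize-shifted {m} c pot Σc≡0 K avoid = φ ∘ c , potential-map φ φ-suc pot , Σd≡0 , bounded
  where
  k = m ℕ.+ suc m
  M = suc k

  R : Fin (suc m) → ℕ
  R v = (c v ℤ.+ + K) %ℕ M
  q : Fin (suc m) → ℤ
  q v = (c v ℤ.+ + K) /ℕ M
  Q : ℤ
  Q = sum q
  offset : ℤ
  offset = + K ℤ.- (Q ℤ.+ Q)

  φ : ℤ → ℤ
  φ z = + ((z ℤ.+ + K) %ℕ M) ℤ.- offset

  φ-suc : ∀ v → φ (ℤ.suc (c v)) ≡ ℤ.suc (φ (c v))
  φ-suc v = begin
    + ((ℤ.suc (c v) ℤ.+ + K) %ℕ M) ℤ.- offset
      ≡⟨ cong (λ z → + (z %ℕ M) ℤ.- offset) (ℤₚ.+-assoc 1ℤ (c v) (+ K)) ⟩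
    + (ℤ.suc (c v ℤ.+ + K) %ℕ M) ℤ.- offset
      ≡⟨ cong (λ x → + x ℤ.- offset) (%ℕ-suc k (c v ℤ.+ + K) (avoid v)) ⟩
    ℤ.suc (+ R v) ℤ.- offset
      ≡⟨ ℤₚ.+-assoc 1ℤ (+ R v) (ℤ.- offset) ⟩
    ℤ.suc (φ (c v)) ∎
    where open ≡-Reasoning

  correction : Fin (suc m) → ℤ
  correction v = (Q ℤ.+ Q) ℤ.- q v ℤ.* + M

  φ-affine : ∀ v → φ (c v) ≡ c v ℤ.+ correction v
  φ-affine v = begin
    + R v ℤ.- offset
      ≡⟨ lemma (+ R v) (q v ℤ.* + M) (+ K) Q ⟩
    ((+ R v ℤ.+ q v ℤ.* + M) ℤ.- + K) ℤ.+ correction v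
      ≡⟨ cong (λ x → (x ℤ.- + K) ℤ.+ correction v) (sym (a≡a%ℕn+[a/ℕn]*n (c v ℤ.+ + K) M)) ⟩
    ((c v ℤ.+ + K) ℤ.- + K) ℤ.+ correction v
      ≡⟨ cong (ℤ._+ correction v) (lemma′ (c v) (+ K)) ⟩
    c v ℤ.+ correction v ∎
    where
    open ≡-Reasoning
    lemma : ∀ r x K Q → r ℤ.- (K ℤ.- (Q ℤ.+ Q)) ≡ ((r ℤ.+ x) ℤ.- K) ℤ.+ ((Q ℤ.+ Q) ℤ.- x)
    lemma = solve-∀
    lemma′ : ∀ c K → (c ℤ.+ K) ℤ.- K ≡ c
    lemma′ = solve-∀

  sum-correction : sum correction ≡ 0ℤ
  sum-correction = begin
    sum (λ v → (Q ℤ.+ Q) ℤ.+ ℤ.- (q v ℤ.* + M))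
      ≡⟨ sum-distrib-+ (λ _ → Q ℤ.+ Q) (λ v → ℤ.- (q v ℤ.* + M)) ⟩
    sum {suc m} (λ _ → Q ℤ.+ Q) ℤ.+ sum (λ v → ℤ.- (q v ℤ.* + M))
      ≡⟨ cong₂ ℤ._+_ (sum-const (suc m) (Q ℤ.+ Q)) (sum-neg (λ v → q v ℤ.* + M)) ⟩
    + suc m ℤ.* (Q ℤ.+ Q) ℤ.- sum (λ v → q v ℤ.* + M)
      ≡⟨ cong (λ x → + suc m ℤ.* (Q ℤ.+ Q) ℤ.- x) (sym (*-distribʳ-sum (+ M) q)) ⟩
    + suc m ℤ.* (Q ℤ.+ Q) ℤ.- Q ℤ.* + (suc m ℕ.+ suc m)
      ≡⟨ cong (λ x → + suc m ℤ.* (Q ℤ.+ Q) ℤ.- Q ℤ.* x) (ℤₚ.pos-+ (suc m) (suc m)) ⟩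
    + suc m ℤ.* (Q ℤ.+ Q) ℤ.- Q ℤ.* (+ suc m ℤ.+ + suc m)
      ≡⟨ lemma (+ suc m) Q ⟩
    0ℤ ∎
    where
    open ≡-Reasoning
    lemma : ∀ n Q → n ℤ.* (Q ℤ.+ Q) ℤ.- Q ℤ.* (n ℤ.+ n) ≡ 0ℤ
    lemma = solve-∀

  Σd≡0 : sum (φ ∘ c) ≡ 0ℤ
  Σd≡0 = trans (sum-cong-≗ φ-affine)
    (trans (sum-distrib-+ c correction) (cong₂ ℤ._+_ Σc≡0 sum-correction))

  bounded : ∀ v → ℤ.∣ φ (c v) ∣ ℕ.≤ M
  bounded v = begin
    ℤ.∣ + R v ℤ.- offset ∣      ≡⟨ cong (λ x → ℤ.∣ + R v ℤ.- x ∣) (sym +∣offset∣≡offset) ⟩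
    ℤ.∣ + R v ℤ.- + ∣offset∣ ∣  ≡⟨ cong ℤ.∣_∣ (ℤₚ.m-n≡m⊖n (R v) ∣offset∣) ⟩
    ℤ.∣ R v ℤ.⊖ ∣offset∣ ∣      ≤⟨ ℤₚ.∣m⊝n∣≤m⊔n (R v) ∣offset∣ ⟩
    R v ℕ.⊔ ∣offset∣            ≤⟨ ℕₚ.⊔-lub (ℕₚ.<⇒≤ (R<M v)) (ℕₚ.<⇒≤ ∣offset∣<M) ⟩
    M                           ∎
    where
    open ℕₚ.≤-Reasoning
    R<M : ∀ v → R v ℕ.< M
    R<M v = n%ℕd<d (c v ℤ.+ + K) M
    0≤offset : 0ℤ ℤ.≤ offset
    0≤offset = let u , du≤0 = sum≡0⇒∃≤0 (φ ∘ c) Σd≡0 in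
      ℤₚ.≤-trans (ℤ.+≤+ ℕ.z≤n) (ℤₚ.i-j≤0⇒i≤j {+ R u} {offset} du≤0)
    ∣offset∣ = ℤ.∣ offset ∣
    +∣offset∣≡offset : + ∣offset∣ ≡ offset
    +∣offset∣≡offset = ℤₚ.0≤i⇒+∣i∣≡i 0≤offset
    ∣offset∣<M : ∣offset∣ ℕ.< M
    ∣offset∣<M = let u , 0≤du = sum≡0⇒∃≥0 (φ ∘ c) Σd≡0 in
      ℕₚ.≤-<-trans (ℤₚ.drop‿+≤+ (subst (ℤ._≤ + R u) (sym +∣offset∣≡offset)
        (ℤₚ.0≤i-j⇒j≤i {+ R u} {offset} 0≤du))) (R<M u)

normalize : {γ o : Orient n} (c : Fin n → ℤ) → Potential γ o c → sum c ≡ 0ℤ →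
  ∃[ d ] (Potential γ o d × sum d ≡ 0ℤ × ∀ v → ℤ.∣ d v ∣ ℕ.≤ n ℕ.+ n)
normalize {n = zero}  c pot Σc≡0 = c , pot , Σc≡0 , λ ()
normalize {n = suc m} c pot Σc≡0
  with ∃-shift-avoiding-top (m ℕ.+ suc m) (ℕ.s≤s (ℕₚ.m≤n+m (suc m) m)) c
... | K , avoid = normalize-shifted c pot Σc≡0 K avoid

ℕ→ℚ-mono-≤ : ∀ {k m} → k ℕ.≤ m → ℕ→ℚ k ≤ ℕ→ℚ m
ℕ→ℚ-mono-≤ {k} {m} k≤m
  rewrite ℚₚ.normalize-coprime (coprime-sym (1-coprimeTo k))
        | ℚₚ.normalize-coprime (coprime-sym (1-coprimeTo m))
  = *≤* (subst₂ ℤ._≤_ (sym (ℤₚ.*-identityʳ (+ k))) (sym (ℤₚ.*-identityʳ (+ m))) (ℤ.+≤+ k≤m))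

*[1+0]-identity : ∀ q → q * (1ℚ + 0ℚ) ≡ q
*[1+0]-identity q = trans (cong (q *_) (ℚₚ.+-identityʳ 1ℚ)) (ℚₚ.*-identityʳ q)

0-tendsToZero : TendsToZero (λ _ → 0ℚ)
0-tendsToZero ε 0<ε = 0 , λ _ _ → 0<ε

n*[n+n]≤4*n^4 : ∀ n → n ℕ.* (n ℕ.+ n) ℕ.≤ 4 ℕ.* n ^ 4
n*[n+n]≤4*n^4 zero    = ℕ.z≤n
n*[n+n]≤4*n^4 n@(suc _) = subst (n ℕ.* (n ℕ.+ n) ℕ.≤_) (sym (lemma n)) (ℕₚ.m≤m*n _ (2 ℕ.* n ℕ.* n))
  where
  -- n ^ 4 written out, as the ring solver does not accept _^_
  lemma : ∀ n → 4 ℕ.* (n ℕ.* (n ℕ.* (n ℕ.* (n ℕ.* 1)))) ≡ n ℕ.* (n ℕ.+ n) ℕ.* (2 ℕ.* n ℕ.* n)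
  lemma = ℕSolver.solve-∀

diameter-bound : ∀ (n : ℕ) (G : SimpleGraph n) (α α'' : Orient n) →
  IsAcyclicOrientation G α → IsAcyclicOrientation G α'' → DFEquivalent G α α'' →
  ∃[ k ] (k ℕ.≤ n ℕ.* (n ℕ.+ n) × DFSteps G k α α'')
diameter-bound n G α α'' Aα (α''O , _) (k₀ , path) with potential-of-path k₀ path
... | c , pot , Σc≡0 with normalize c pot Σc≡0
...   | d , pot′ , Σd≡0 , ∣d∣≤2n with Descent.descend α''O _ (Aα , pot′ , Σd≡0) ℕₚ.≤-refl
...     | k , k≤μd , steps = k , ℕₚ.≤-trans k≤μd (sumℕ-≤-* (n ℕ.+ n) ∣d∣≤2n) , steps

corollary3p10 :
    ∃[ f ] (TendsToZero f ×
      (∀ (n : ℕ) (G : SimpleGraph n) (α α'' : Orient n) →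
        IsAcyclicOrientation G α → IsAcyclicOrientation G α'' →
        DFEquivalent G α α'' →
        ∃[ k ] (ℕ→ℚ k ≤ ℕ→ℚ (4 *ℕ n ^ 4) * (1ℚ + f n) × DFSteps G k α α'')))
corollary3p10 = (λ _ → 0ℚ) , 0-tendsToZero , λ n G α α'' Aα Aα'' equivalent →
  let k , k≤2n² , steps = diameter-bound n G α α'' Aα Aα'' equivalent in
  k , subst (ℕ→ℚ k ≤_) (sym (*[1+0]-identity _))
        (ℕ→ℚ-mono-≤ (ℕₚ.≤-trans k≤2n² (n*[n+n]≤4*n^4 n))) ,
  steps
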